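{- Let $N=\{p_1,\dots,p_n\}$ be a finite set of propositional variables and let $t\subseteq 2^N$ be a nonempty $N$-team with $|t|=k+1$. Define: $\chi_v=p_1^{v(p_1)}\wedge\dots\wedge p_n^{v(p_n)}$ for $v\in 2^N$ (with $p_i^1=p_i$, $p_i^0=\neg p_i$); $\chi_{\bar t}=\bigvee_{v\in\bar t}\chi_v$ where $\bar t=2^N\setminus t$; $\mu_k=\bigvee_{i=1}^k(=\!(p_1)\wedge\dots\wedge=\!(p_n))$; $\rho_t=\mu_k\vee\chi_{\bar t}$; $\iota_v$ the inclusion atom $x_1\dots x_n\subseteq p_1\dots p_n$ with $x_i=\top$ if $v(p_i)=1$ and $x_i=\bot$ if $v(p_i)=0$; and $\sigma_t=\bigvee_{v\in\bar t}\iota_v$. Then for every $N$-team $s$: $s\models\rho_t\vee\sigma_t$ iff $s\neq t$.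
   Context: An $N$-team is a set of valuations $v:N\to\{0,1\}$. All disjunctions $\vee$ are local disjunctions. Team semantics: $s\models p$ iff $v(p)=1$ for all $v\in s$; $s\models\bot$ iff $s=\emptyset$; $s\models\neg\phi$ iff $\{v\}\not\models\phi$ for all $v\in s$; $s\models\phi\wedge\psi$ iff both hold; $s\models\phi\vee\psi$ iff $s=r\cup r'$ for some $r,r'\subseteq s$ with $r\models\phi$, $r'\models\psi$; $s\models=\!(p)$ (constancy atom) iff $v(p)=u(p)$ for all $v,u\in s$; $s\models a_1\dots a_m\subseteq b_1\dots b_m$ iff for every $v\in s$ there is $u\in s$ with $v(a_i)=u(b_i)$ for all $i$, where $v(\top)=1$, $v(\bot)=0$. An empty disjunction is read as $\bot$. -}

module Defs where

open import Data.Bool using (Bool; true; false; if_then_else_; _∨_; not; T)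
open import Data.Bool.Properties using (T?)
open import Data.Nat using (ℕ; zero; suc)
open import Data.Fin using (Fin)
open import Data.Vec using (Vec; []; _∷_; lookup; tabulate)
import Data.Vec as V
open import Data.List using (List; []; _∷_; _++_; map; filter; length; replicate; allFin)
open import Data.Product using (Σ; _×_; ∃)
open import Relation.Binary.PropositionalEquality using (_≡_)
open import Relation.Nullary using (¬_)
open import Relation.Nullary.Decidable using (⌊_⌋)
import Data.Vec.Properties as VP
import Data.Bool as B

-- A valuation of N = {p_0,…,p_{n-1}} (v(p_i) = lookup v i).
Valuation : ℕ → Set
Valuation n = Vec Bool n

Team : ℕ → Set
Team n = Valuation n → Bool

_≐_ : ∀ {n} → Team n → Team n → Set
s ≐ t = ∀ v → s v ≡ t v

single : ∀ {n} → Valuation n → Team n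
single v u = ⌊ VP.≡-dec B._≟_ u v ⌋

allVals : (n : ℕ) → List (Valuation n)
allVals zero = [] ∷ []
allVals (suc n) = map (true ∷_) (allVals n) ++ map (false ∷_) (allVals n)

members : ∀ {n} → Team n → List (Valuation n)
members {n} t = filter (λ v → T? (t v)) (allVals n)

card : ∀ {n} → Team n → ℕ
card t = length (members t)

complement : ∀ {n} → Team n → Team n
complement t v = not (t v)

data Term (n : ℕ) : Set where
  tvar : Fin n → Term n
  ttop : Term n
  tbot : Term n

evalT : ∀ {n} → Valuation n → Term n → Bool
evalT v (tvar i) = lookup v i
evalT v ttop = true
evalT v tbot = false

data Formula (n : ℕ) : Set where
  var   : Fin n → Formula n
  bot   : Formula n
  neg   : Formula n → Formula n
  _∧f_  : Formula n → Formula n → Formula n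
  _∨f_  : Formula n → Formula n → Formula n
  const : Fin n → Formula n
  incl  : ∀ {m} → Vec (Term n) m → Vec (Term n) m → Formula n

_⊨_ : ∀ {n} → Team n → Formula n → Set
s ⊨ var i = ∀ v → s v ≡ true → lookup v i ≡ true
s ⊨ bot = ∀ v → s v ≡ false
s ⊨ neg φ = ∀ v → s v ≡ true → ¬ (single v ⊨ φ)
s ⊨ (φ ∧f ψ) = (s ⊨ φ) × (s ⊨ ψ)
s ⊨ (φ ∨f ψ) = Σ (Team _) λ r → Σ (Team _) λ r' →
  (∀ v → s v ≡ (r v ∨ r' v)) × (r ⊨ φ) × (r' ⊨ ψ)
s ⊨ const i = ∀ v u → s v ≡ true → s u ≡ true → lookup v i ≡ lookup u i
s ⊨ incl as bs = ∀ v → s v ≡ true →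
  ∃ λ u → (s u ≡ true) × (V.map (evalT v) as ≡ V.map (evalT u) bs)

⋁ : ∀ {n} → List (Formula n) → Formula n
⋁ [] = bot
⋁ (φ ∷ φs) = φ ∨f ⋁ φs

⋀ : ∀ {n} → List (Formula n) → Formula n
⋀ [] = neg bot
⋀ (φ ∷ []) = φ
⋀ (φ ∷ φs) = φ ∧f ⋀ φs

χ : ∀ {n} → Valuation n → Formula n
χ {n} v = ⋀ (map (λ i → if lookup v i then var i else neg (var i)) (allFin n))

χbar : ∀ {n} → Team n → Formula n
χbar t = ⋁ (map χ (members (complement t)))

μ : ∀ {n} → ℕ → Formula n
μ {n} k = ⋁ (replicate k (⋀ (map const (allFin n))))

ρ : ∀ {n} → Team n → ℕ → Formula n
ρ t k = μ k ∨f χbar t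

ι : ∀ {n} → Valuation n → Formula n
ι v = incl (V.map (λ b → if b then ttop else tbot) v) (tabulate tvar)

σ : ∀ {n} → Team n → Formula n
σ t = ⋁ (map ι (members (complement t)))

-- In team semantics μ_k holds exactly in teams of at most k valuations, χ_t̄ exactly in
-- subteams of t̄, and σ_t in the empty team and in teams meeting t̄. If s ≠ t, either s meets
-- t̄ and σ_t alone covers s, or s misses a point of t, so s ∩ t has at most k points and
-- satisfies μ_k while s ∖ t satisfies χ_t̄. If s = t, every part of a split of t that has to
-- satisfy σ_t or χ_t̄ lies inside t and is therefore empty, so the k + 1 valuations of t are
-- covered by a team satisfying μ_k, which is impossible.

module Submission where

open import Defs
open import Data.Nat using (ℕ; suc)
open import Relation.Binary.PropositionalEquality using (_≡_)
open import Relation.Nullary using (¬_)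
open import Function.Bundles using (_⇔_)

open import Data.Nat using (zero; _≤_; _<_; _+_; z≤n; s≤s; s≤s⁻¹)
open import Data.Nat.Properties using (≤-trans; +-mono-≤; +-identityʳ; 1+n≰n; module ≤-Reasoning)
open import Data.Bool using (Bool; true; false; _∨_; _∧_; not; if_then_else_)
import Data.Bool as Bool
open import Data.Bool.Properties
  using (T?; T-≡; not-¬; ¬-not; not-injective; ∨-idem; ∨-identityʳ; ∨-zeroʳ)
open import Data.Fin using (Fin)
open import Data.Vec using (Vec; []; _∷_; lookup; tabulate)
open import Data.Vec.Relation.Binary.Pointwise.Extensional using (ext; Pointwise-≡⇒≡)
import Data.Vec as Vec
import Data.Vec.Properties as Vec
open import Data.List using (List; []; _∷_; _++_; map; filter; length; replicate; allFin)
open import Data.List.Properties using (length-++; filter-notAll)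
open import Data.List.Membership.Propositional using (_∈_; find)
open import Data.List.Membership.Propositional.Properties
  using (∈-filter⁺; ∈-filter⁻; ∈-++⁺ˡ; ∈-++⁺ʳ; ∈-map⁺; ∈-map⁻; ∈-allFin)
open import Data.List.Relation.Unary.Any using (Any; here; there; satisfied)
import Data.List.Relation.Unary.Any as Any
import Data.List.Relation.Unary.Any.Properties as Any
open import Data.List.Relation.Unary.All using (All; []; _∷_)
import Data.List.Relation.Unary.All as All
import Data.List.Relation.Unary.All.Properties as All
open import Data.List.Relation.Unary.AllPairs using ([]; _∷_)
open import Data.List.Relation.Unary.Unique.Propositional using (Unique)
import Data.List.Relation.Unary.Unique.Propositional.Properties as Unique
open import Data.Product using (Σ; ∃; _×_; _,_; proj₂)
open import Data.Sum using (_⊎_; inj₁; inj₂)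
open import Data.Empty using (⊥; ⊥-elim)
open import Function using (_∘_)
open import Function.Bundles using (mk⇔; Equivalence)
open import Relation.Binary.Definitions using (DecidableEquality)
open import Relation.Binary.PropositionalEquality
  using (refl; sym; trans; cong; subst; _≢_)
open import Relation.Nullary using (yes; no; ¬?)

private
  variable
    n k : ℕ

module _ {a} {A : Set a} (_≟_ : DecidableEquality A) where

  mutual
    unique-length-≤ : ∀ {xs ys : List A} → Unique xs → (∀ {x} → x ∈ xs → x ∈ ys) →
                      length xs ≤ length ys
    unique-length-≤ {[]} _ _ = z≤n
    unique-length-≤ {x ∷ xs} (x∉xs ∷ xs!) xs⊆ys =
      unique-length-< xs! (xs⊆ys ∘ there) (xs⊆ys (here refl)) (λ x∈xs → All.lookup x∉xs x∈xs refl)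

    unique-length-< : ∀ {xs ys : List A} {y} → Unique xs → (∀ {x} → x ∈ xs → x ∈ ys) →
                      y ∈ ys → ¬ y ∈ xs → length xs < length ys
    unique-length-< {xs} {ys} {y} xs! xs⊆ys y∈ys y∉xs = ≤-trans
      (s≤s (unique-length-≤ xs! (λ x∈xs → ∈-filter⁺ y≢? (xs⊆ys x∈xs) (λ { refl → y∉xs x∈xs }))))
      (filter-notAll y≢? ys (Any.map (λ y≡z y≢z → y≢z y≡z) y∈ys))
      where
      y≢? = λ z → ¬? (y ≟ z)

  unique-length-≤1 : ∀ {xs : List A} → Unique xs → (∀ {x y} → x ∈ xs → y ∈ xs → x ≡ y) →
                     length xs ≤ 1
  unique-length-≤1 {[]} _ _ = z≤n
  unique-length-≤1 {x ∷ _} xs! all-equal =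
    unique-length-≤ {ys = x ∷ []} xs! (λ y∈xs → here (all-equal y∈xs (here refl)))

allVals-unique : ∀ n → Unique (allVals n)
allVals-unique zero = [] ∷ []
allVals-unique (suc n) =
  Unique.++⁺ (Unique.map⁺ Vec.∷-injectiveʳ (allVals-unique n))
             (Unique.map⁺ Vec.∷-injectiveʳ (allVals-unique n))
             disjoint
  where
  disjoint : ∀ {v} → ¬ (v ∈ map (true ∷_) (allVals n) × v ∈ map (false ∷_) (allVals n))
  disjoint (v∈trues , v∈falses) with ∈-map⁻ _ v∈trues | ∈-map⁻ _ v∈falses
  ... | _ , _ , refl | _ , _ , ()

allVals-complete : ∀ {n} (v : Valuation n) → v ∈ allVals n
allVals-complete [] = here refl
allVals-complete {suc n} (true ∷ v) = ∈-++⁺ˡ (∈-map⁺ (true ∷_) (allVals-complete v))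
allVals-complete {suc n} (false ∷ v) =
  ∈-++⁺ʳ (map (true ∷_) (allVals n)) (∈-map⁺ (false ∷_) (allVals-complete v))

∅ : Team n
∅ _ = false

_∪_ _∩_ _∖_ : Team n → Team n → Team n
(s ∪ r) v = s v ∨ r v
(s ∩ r) v = s v ∧ r v
(s ∖ r) v = s v ∧ not (r v)

_⊆_ : Team n → Team n → Set
r ⊆ s = ∀ {v} → r v ≡ true → s v ≡ true

_⊆ₗ_ : Team n → List (Valuation n) → Set
s ⊆ₗ xs = ∀ {v} → s v ≡ true → v ∈ xs

Subsingleton : Team n → Set
Subsingleton c = ∀ {u w} → c u ≡ true → c w ≡ true → u ≡ w

∩-⊆ʳ : {s r : Team n} → (s ∩ r) ⊆ r
∩-⊆ʳ {s = s} {v = v} with s v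
... | true = λ r-v → r-v
... | false = λ ()

∖-⊆ : {s r : Team n} → (s ∖ r) ⊆ s
∖-⊆ {s = s} {v = v} with s v
... | true = λ _ → refl
... | false = λ ()

∖-⊆∁ : {s r : Team n} → (s ∖ r) ⊆ complement r
∖-⊆∁ {s = s} {v = v} with s v
... | true = λ r̄-v → r̄-v
... | false = λ ()

∪-⊆ˡ : {s r r' : Team n} → s ≐ (r ∪ r') → r ⊆ s
∪-⊆ˡ s≡r∪r' {v} r-v rewrite s≡r∪r' v | r-v = refl

∪-⊆ʳ : {s r r' : Team n} → s ≐ (r ∪ r') → r' ⊆ s
∪-⊆ʳ {r = r} s≡r∪r' {v} r'-v rewrite s≡r∪r' v | r'-v = ∨-zeroʳ (r v)

∪-cases : {s r r' : Team n} {v : Valuation n} → s ≐ (r ∪ r') →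
          s v ≡ true → r v ≡ true ⊎ r' v ≡ true
∪-cases {r = r} {r'} {v} s≡r∪r' s-v with r v | r' v | trans (sym (s≡r∪r' v)) s-v
... | true | _ | _ = inj₁ refl
... | false | true | _ = inj₂ refl
... | false | false | ()

∈-single⁺ : {v u : Valuation n} → u ≡ v → single v u ≡ true
∈-single⁺ {v = v} {u} with Vec.≡-dec Bool._≟_ u v
... | yes _ = λ _ → refl
... | no u≢v = λ u≡v → ⊥-elim (u≢v u≡v)

∈-single⁻ : {v u : Valuation n} → single v u ≡ true → u ≡ v
∈-single⁻ {v = v} {u} with Vec.≡-dec Bool._≟_ u v
... | yes u≡v = λ _ → u≡v
... | no _ = λ ()

⊆-single⇒subsingleton : {c : Team n} {x : Valuation n} → c ⊆ single x → Subsingleton c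
⊆-single⇒subsingleton c⊆x c-u c-w = trans (∈-single⁻ (c⊆x c-u)) (sym (∈-single⁻ (c⊆x c-w)))

valuation-≟ : DecidableEquality (Valuation n)
valuation-≟ = Vec.≡-dec Bool._≟_

∈-members⁺ : {t : Team n} {v : Valuation n} → t v ≡ true → v ∈ members t
∈-members⁺ {t = t} t-v = ∈-filter⁺ (λ v → T? (t v)) (allVals-complete _) (Equivalence.from T-≡ t-v)

∈-members⁻ : {t : Team n} {v : Valuation n} → v ∈ members t → t v ≡ true
∈-members⁻ {n} {t} v∈t =
  Equivalence.to T-≡ (proj₂ (∈-filter⁻ (λ v → T? (t v)) {xs = allVals n} v∈t))

members-unique : (t : Team n) → Unique (members t)
members-unique t = Unique.filter⁺ (λ v → T? (t v)) (allVals-unique _)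

card-≤-length : {t : Team n} {xs : List (Valuation n)} → t ⊆ₗ xs → card t ≤ length xs
card-≤-length {t = t} t⊆xs =
  unique-length-≤ valuation-≟ (members-unique t) (λ v∈t → t⊆xs (∈-members⁻ v∈t))

card-mono : {r s : Team n} → r ⊆ s → card r ≤ card s
card-mono {s = s} r⊆s = card-≤-length {xs = members s} (λ r-v → ∈-members⁺ (r⊆s r-v))

card-< : {r t : Team n} {v : Valuation n} → r ⊆ t → t v ≡ true → r v ≡ false → card r < card t
card-< {r = r} r⊆t t-v r-v = unique-length-< valuation-≟ (members-unique r)
  (λ v∈r → ∈-members⁺ (r⊆t (∈-members⁻ v∈r))) (∈-members⁺ t-v) (λ v∈r → not-¬ (∈-members⁻ v∈r) r-v)

card-∪ : {s r r' : Team n} → s ≐ (r ∪ r') → card s ≤ card r + card r'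
card-∪ {s = s} {r} {r'} s≡r∪r' = begin
  card s                                ≤⟨ card-≤-length s⊆r++r' ⟩
  length (members r ++ members r')      ≡⟨ length-++ (members r) ⟩
  card r + card r'                      ∎
  where
  open ≤-Reasoning
  s⊆r++r' : s ⊆ₗ (members r ++ members r')
  s⊆r++r' s-v with ∪-cases {r = r} {r'} s≡r∪r' s-v
  ... | inj₁ r-v = ∈-++⁺ˡ (∈-members⁺ r-v)
  ... | inj₂ r'-v = ∈-++⁺ʳ (members r) (∈-members⁺ r'-v)

card-subsingleton : {c : Team n} → Subsingleton c → card c ≤ 1
card-subsingleton {c = c} c! = unique-length-≤1 valuation-≟ (members-unique c)
  (λ u∈c w∈c → c! (∈-members⁻ {t = c} u∈c) (∈-members⁻ {t = c} w∈c))

∉-⊨bot : {s : Team n} {v : Valuation n} → s ⊨ bot → s v ≡ true → ⊥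
∉-⊨bot {v = v} s⊨bot s-v = not-¬ s-v (s⊨bot v)

card-⊨bot : {s : Team n} → s ⊨ bot → card s ≤ 0
card-⊨bot s⊨bot = card-≤-length {xs = []} (λ {v} s-v → ⊥-elim (∉-⊨bot {v = v} s⊨bot s-v))

⊨-empty : (φ : Formula n) {s : Team n} → s ⊨ bot → s ⊨ φ
⊨-empty (var i) s⊨bot v s-v = ⊥-elim (∉-⊨bot s⊨bot s-v)
⊨-empty bot s⊨bot = s⊨bot
⊨-empty (neg φ) s⊨bot v s-v = ⊥-elim (∉-⊨bot s⊨bot s-v)
⊨-empty (φ ∧f ψ) s⊨bot = ⊨-empty φ s⊨bot , ⊨-empty ψ s⊨bot
⊨-empty (φ ∨f ψ) {s} s⊨bot = s , s , (λ v → sym (∨-idem (s v))) , ⊨-empty φ s⊨bot , ⊨-empty ψ s⊨bot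
⊨-empty (const i) s⊨bot v u s-v = ⊥-elim (∉-⊨bot s⊨bot s-v)
⊨-empty (incl as bs) s⊨bot v s-v = ⊥-elim (∉-⊨bot s⊨bot s-v)

∅-⊨ : (φ : Formula n) → ∅ ⊨ φ
∅-⊨ φ = ⊨-empty φ (λ _ → refl)

⊨∨-introˡ : {φ ψ : Formula n} {s : Team n} → s ⊨ φ → s ⊨ (φ ∨f ψ)
⊨∨-introˡ {ψ = ψ} {s} s⊨φ = s , ∅ , (λ v → sym (∨-identityʳ (s v))) , s⊨φ , ∅-⊨ ψ

⊨∨-introʳ : {φ ψ : Formula n} {s : Team n} → s ⊨ ψ → s ⊨ (φ ∨f ψ)
⊨∨-introʳ {φ = φ} s⊨ψ = ∅ , _ , (λ _ → refl) , ∅-⊨ φ , s⊨ψ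

⊨∨-partition : {φ ψ : Formula n} {s : Team n} (r : Team n) →
               (s ∩ r) ⊨ φ → (s ∖ r) ⊨ ψ → s ⊨ (φ ∨f ψ)
⊨∨-partition {s = s} r s∩r⊨φ s∖r⊨ψ =
  s ∩ r , s ∖ r , (λ v → partition (s v) (r v)) , s∩r⊨φ , s∖r⊨ψ
  where
  partition : ∀ a b → a ≡ (a ∧ b) ∨ (a ∧ not b)
  partition true true = refl
  partition true false = refl
  partition false _ = refl

⊨⋁-∈ : {φ : Formula n} {φs : List (Formula n)} {s : Team n} → φ ∈ φs → s ⊨ φ → s ⊨ ⋁ φs
⊨⋁-∈ (here refl) s⊨φ = ⊨∨-introˡ s⊨φ
⊨⋁-∈ (there φ∈φs) s⊨φ = ⊨∨-introʳ (⊨⋁-∈ φ∈φs s⊨φ)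

⊨⋁⁻ : (φs : List (Formula n)) {s : Team n} {v : Valuation n} → s ⊨ ⋁ φs → s v ≡ true →
      Any (λ φ → Σ (Team n) λ r → r ⊆ s × r v ≡ true × r ⊨ φ) φs
⊨⋁⁻ [] s⊨bot s-v = ⊥-elim (∉-⊨bot s⊨bot s-v)
⊨⋁⁻ (φ ∷ φs) (r , r' , s≡r∪r' , r⊨φ , r'⊨φs) s-v with ∪-cases {r = r} {r'} s≡r∪r' s-v
... | inj₁ r-v = here (r , ∪-⊆ˡ {r = r} {r'} s≡r∪r' , r-v , r⊨φ)
... | inj₂ r'-v = there (Any.map
  (λ (q , q⊆r' , q-v , q⊨ψ) → q , (λ {u} q-u → ∪-⊆ʳ {r = r} s≡r∪r' (q⊆r' {u} q-u)) , q-v , q⊨ψ)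
  (⊨⋁⁻ φs r'⊨φs r'-v))

⊨⋀⁻ : (φs : List (Formula n)) {s : Team n} → s ⊨ ⋀ φs → All (s ⊨_) φs
⊨⋀⁻ [] _ = []
⊨⋀⁻ (φ ∷ []) s⊨φ = s⊨φ ∷ []
⊨⋀⁻ (φ ∷ ψ ∷ φs) (s⊨φ , s⊨ψs) = s⊨φ ∷ ⊨⋀⁻ (ψ ∷ φs) s⊨ψs

⊨⋀⁺ : (φs : List (Formula n)) {s : Team n} → All (s ⊨_) φs → s ⊨ ⋀ φs
⊨⋀⁺ [] [] v _ single⊨bot = ∉-⊨bot single⊨bot (∈-single⁺ {v = v} refl)
⊨⋀⁺ (φ ∷ []) (s⊨φ ∷ []) = s⊨φ
⊨⋀⁺ (φ ∷ ψ ∷ φs) (s⊨φ ∷ s⊨ψs) = s⊨φ , ⊨⋀⁺ (ψ ∷ φs) s⊨ψs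

⊨⋀-allFin⁻ : (φ : Fin n → Formula n) {s : Team n} → s ⊨ ⋀ (map φ (allFin n)) → ∀ i → s ⊨ φ i
⊨⋀-allFin⁻ φ s⊨⋀ i = All.lookup (All.map⁻ (⊨⋀⁻ (map φ (allFin _)) s⊨⋀)) (∈-allFin i)

⊨⋀-allFin⁺ : (φ : Fin n → Formula n) {s : Team n} → (∀ i → s ⊨ φ i) → s ⊨ ⋀ (map φ (allFin n))
⊨⋀-allFin⁺ φ s⊨φ = ⊨⋀⁺ (map φ (allFin _)) (All.map⁺ (All.tabulate (λ {i} _ → s⊨φ i)))

single⊨var⁻ : {w : Valuation n} {i : Fin n} → single w ⊨ var i → lookup w i ≡ true
single⊨var⁻ {w = w} w⊨p = w⊨p w (∈-single⁺ {v = w} refl)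

single⊨var⁺ : {w : Valuation n} {i : Fin n} → lookup w i ≡ true → single w ⊨ var i
single⊨var⁺ w-i u u∈w rewrite ∈-single⁻ u∈w = w-i

literal : Valuation n → Fin n → Formula n
literal x i = if lookup x i then var i else neg (var i)

⊨literal⁻ : {c : Team n} {x w : Valuation n} {i : Fin n} →
            c ⊨ literal x i → c w ≡ true → lookup w i ≡ lookup x i
⊨literal⁻ {x = x} {w} {i} with lookup x i
... | true = λ c⊨p c-w → c⊨p w c-w
... | false = λ c⊨¬p c-w → ¬-not (λ w-i → c⊨¬p w c-w (single⊨var⁺ w-i))

⊨literal⁺ : {c : Team n} {x : Valuation n} {i : Fin n} →
            (∀ {w} → c w ≡ true → lookup w i ≡ lookup x i) → c ⊨ literal x i
⊨literal⁺ {x = x} {i} with lookup x i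
... | true = λ agree w c-w → agree c-w
... | false = λ agree w c-w w⊨p → not-¬ (single⊨var⁻ w⊨p) (agree c-w)

⊨χ⁻ : {c : Team n} {x : Valuation n} → c ⊨ χ x → c ⊆ single x
⊨χ⁻ {x = x} c⊨χ c-w =
  ∈-single⁺ (Pointwise-≡⇒≡ (ext λ i → ⊨literal⁻ {x = x} (⊨⋀-allFin⁻ (literal x) c⊨χ i) c-w))

⊨χ⁺ : {c : Team n} {x : Valuation n} → c ⊆ single x → c ⊨ χ x
⊨χ⁺ {x = x} c⊆x = ⊨⋀-allFin⁺ (literal x) λ i →
  ⊨literal⁺ {x = x} (λ c-w → cong (λ u → lookup u i) (∈-single⁻ (c⊆x c-w)))

allConstant : Formula n
allConstant {n} = ⋀ (map const (allFin n))

⊨allConstant⁻ : {c : Team n} → c ⊨ allConstant → Subsingleton c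
⊨allConstant⁻ c⊨ c-u c-w = Pointwise-≡⇒≡ (ext λ i → ⊨⋀-allFin⁻ const c⊨ i _ _ c-u c-w)

⊨allConstant⁺ : {c : Team n} → Subsingleton c → c ⊨ allConstant
⊨allConstant⁺ c! = ⊨⋀-allFin⁺ const λ i u w c-u c-w → cong (λ v → lookup v i) (c! c-u c-w)

evalT-constants : ∀ {m} (w : Valuation n) (x : Vec Bool m) →
                  Vec.map (evalT w) (Vec.map (λ b → if b then ttop else tbot) x) ≡ x
evalT-constants w [] = refl
evalT-constants w (true ∷ x) = cong (true ∷_) (evalT-constants w x)
evalT-constants w (false ∷ x) = cong (false ∷_) (evalT-constants w x)

evalT-variables : (u : Valuation n) → Vec.map (evalT u) (tabulate tvar) ≡ u
evalT-variables u = trans (sym (Vec.tabulate-∘ (evalT u) tvar)) (Vec.tabulate∘lookup u)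

⊨ι⁻ : {r : Team n} {x w : Valuation n} → r ⊨ ι x → r w ≡ true → r x ≡ true
⊨ι⁻ {r = r} {x} {w} r⊨ι r-w with r⊨ι w r-w
... | u , r-u , x≡u = subst (λ y → r y ≡ true) (sym x=u) r-u
  where
  x=u : x ≡ u
  x=u = trans (sym (evalT-constants w x)) (trans x≡u (evalT-variables u))

⊨ι⁺ : {s : Team n} {x : Valuation n} → s x ≡ true → s ⊨ ι x
⊨ι⁺ {x = x} s-x w _ = x , s-x , trans (evalT-constants w x) (sym (evalT-variables x))

⊆ₗ[]⇒⊨bot : {s : Team n} → s ⊆ₗ [] → s ⊨ bot
⊆ₗ[]⇒⊨bot s⊆[] v = ¬-not {y = true} (λ s-v → Any.¬Any[] (s⊆[] {v} s-v))

∖single-⊆ₗ : {s : Team n} {x : Valuation n} {xs : List (Valuation n)} →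
             s ⊆ₗ (x ∷ xs) → (s ∖ single x) ⊆ₗ xs
∖single-⊆ₗ {s = s} {x} s⊆x∷xs {v} s∖x-v with s⊆x∷xs (∖-⊆ {s = s} {single x} s∖x-v)
... | here refl = ⊥-elim (not-¬ (∖-⊆∁ {s = s} {single x} s∖x-v) (cong not (∈-single⁺ {v = x} refl)))
... | there v∈xs = v∈xs

⊨⋁-map : (φ : Valuation n → Formula n) → (∀ {x c} → c ⊆ single x → c ⊨ φ x) →
         {s : Team n} (xs : List (Valuation n)) → s ⊆ₗ xs → s ⊨ ⋁ (map φ xs)
⊨⋁-map φ φ-local [] s⊆[] = ⊆ₗ[]⇒⊨bot s⊆[]
⊨⋁-map φ φ-local {s} (x ∷ xs) s⊆x∷xs =
  ⊨∨-partition (single x) (φ-local (∩-⊆ʳ {s = s} {single x}))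
                          (⊨⋁-map φ φ-local xs (∖single-⊆ₗ s⊆x∷xs))

⊨⋁-replicate : {φ : Formula n} → (∀ {c} → Subsingleton c → c ⊨ φ) →
               {s : Team n} (xs : List (Valuation n)) → s ⊆ₗ xs → length xs ≤ k →
               s ⊨ ⋁ (replicate k φ)
⊨⋁-replicate {φ = φ} _ [] s⊆[] _ = ⊨-empty (⋁ (replicate _ φ)) (⊆ₗ[]⇒⊨bot s⊆[])
⊨⋁-replicate φ-sub {s} (x ∷ xs) s⊆x∷xs (s≤s |xs|≤k) =
  ⊨∨-partition (single x) (φ-sub (⊆-single⇒subsingleton (∩-⊆ʳ {s = s} {single x})))
                          (⊨⋁-replicate φ-sub xs (∖single-⊆ₗ s⊆x∷xs) |xs|≤k)

card-⊨⋁-replicate : {φ : Formula n} → (∀ {c} → c ⊨ φ → Subsingleton c) →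
                    {s : Team n} → s ⊨ ⋁ (replicate k φ) → card s ≤ k
card-⊨⋁-replicate {k = zero} _ s⊨bot = card-⊨bot s⊨bot
card-⊨⋁-replicate {k = suc k} φ-sub {s} (c , r , s≡c∪r , c⊨φ , r⊨φs) = begin
  card s           ≤⟨ card-∪ {r = c} {r} s≡c∪r ⟩
  card c + card r  ≤⟨ +-mono-≤ (card-subsingleton (φ-sub c⊨φ)) (card-⊨⋁-replicate φ-sub r⊨φs) ⟩
  1 + k            ∎
  where open ≤-Reasoning

⊨μ⁻ : {s : Team n} → s ⊨ μ k → card s ≤ k
⊨μ⁻ = card-⊨⋁-replicate ⊨allConstant⁻

⊨μ⁺ : {s : Team n} → card s ≤ k → s ⊨ μ k
⊨μ⁺ {s = s} = ⊨⋁-replicate ⊨allConstant⁺ (members s) ∈-members⁺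

⊨χbar⁻ : {s t : Team n} → s ⊨ χbar t → s ⊆ complement t
⊨χbar⁻ {t = t} s⊨χbar {v} s-v
  with find (Any.map⁻ (⊨⋁⁻ (map χ (members (complement t))) s⊨χbar s-v))
... | x , x∈t̄ , r , _ , r-v , r⊨χx with ∈-single⁻ {v = x} (⊨χ⁻ r⊨χx r-v)
... | refl = ∈-members⁻ x∈t̄

⊨χbar⁺ : {s t : Team n} → s ⊆ complement t → s ⊨ χbar t
⊨χbar⁺ {t = t} s⊆t̄ = ⊨⋁-map χ ⊨χ⁺ (members (complement t)) (λ s-v → ∈-members⁺ (s⊆t̄ s-v))

⊨σ⁻ : {s t : Team n} {w : Valuation n} → s ⊨ σ t → s w ≡ true →
      ∃ λ u → s u ≡ true × t u ≡ false
⊨σ⁻ {t = t} s⊨σ s-w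
  with find (Any.map⁻ (⊨⋁⁻ (map ι (members (complement t))) s⊨σ s-w))
... | x , x∈t̄ , r , r⊆s , r-w , r⊨ιx = x , r⊆s (⊨ι⁻ r⊨ιx r-w) , not-injective (∈-members⁻ x∈t̄)

⊨σ⁺ : {s t : Team n} {u : Valuation n} → s u ≡ true → t u ≡ false → s ⊨ σ t
⊨σ⁺ s-u t-u = ⊨⋁-∈ (∈-map⁺ ι (∈-members⁺ (cong not t-u))) (⊨ι⁺ s-u)

¬≐⇒∃≢ : {s t : Team n} → ¬ (s ≐ t) → ∃ λ v → s v ≢ t v
¬≐⇒∃≢ {n} {s} {t} s≢t = satisfied (All.¬All⇒Any¬ (λ v → s v Bool.≟ t v) (allVals n)
  (λ s≡t → s≢t (λ v → All.lookup s≡t (allVals-complete v))))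

⊨χbar-inside : {s t : Team n} → s ⊨ χbar t → s ⊆ t → s ⊨ bot
⊨χbar-inside s⊨χbar s⊆t v = ¬-not {y = true} λ s-v → not-¬ (⊨χbar⁻ s⊨χbar s-v) (cong not (s⊆t s-v))

⊨σ-inside : {s t : Team n} → s ⊨ σ t → s ⊆ t → s ⊨ bot
⊨σ-inside s⊨σ s⊆t v = ¬-not {y = true} λ s-v →
  let u , s-u , t-u = ⊨σ⁻ s⊨σ s-v in not-¬ (s⊆t s-u) t-u

card-⊨ρ-inside : {s t : Team n} → s ⊨ ρ t k → s ⊆ t → card s ≤ k
card-⊨ρ-inside {k = k} {s} (a , b , s≐a∪b , a⊨μ , b⊨χbar) s⊆t = begin
  card s           ≤⟨ card-∪ {r = a} {b} s≐a∪b ⟩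
  card a + card b  ≤⟨ +-mono-≤ (⊨μ⁻ a⊨μ)
                               (card-⊨bot (⊨χbar-inside b⊨χbar (s⊆t ∘ ∪-⊆ʳ {r = a} s≐a∪b))) ⟩
  k + 0            ≡⟨ +-identityʳ k ⟩
  k                ∎
  where open ≤-Reasoning

card-⊨ρ∨σ-inside : {s t : Team n} → s ⊨ (ρ t k ∨f σ t) → s ⊆ t → card s ≤ k
card-⊨ρ∨σ-inside {k = k} {s} (r , r' , s≐r∪r' , r⊨ρ , r'⊨σ) s⊆t = begin
  card s            ≤⟨ card-∪ {r = r} {r'} s≐r∪r' ⟩
  card r + card r'  ≤⟨ +-mono-≤ (card-⊨ρ-inside r⊨ρ (s⊆t ∘ ∪-⊆ˡ {r = r} {r'} s≐r∪r'))
                                (card-⊨bot (⊨σ-inside r'⊨σ (s⊆t ∘ ∪-⊆ʳ {r = r} s≐r∪r'))) ⟩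
  k + 0             ≡⟨ +-identityʳ k ⟩
  k                 ∎
  where open ≤-Reasoning

⊨ρ⁺ : {s t : Team n} {v : Valuation n} → card t ≡ suc k → t v ≡ true → s v ≡ false → s ⊨ ρ t k
⊨ρ⁺ {k = k} {s} {t} {v} |t|≡1+k t-v s-v =
  ⊨∨-partition {φ = μ k} {χbar t} t (⊨μ⁺ |s∩t|≤k) (⊨χbar⁺ (∖-⊆∁ {s = s} {t}))
  where
  |s∩t|<|t| : card (s ∩ t) < card t
  |s∩t|<|t| = card-< {r = s ∩ t} {t} (∩-⊆ʳ {s = s} {t}) t-v (cong (_∧ t v) s-v)
  |s∩t|≤k : card (s ∩ t) ≤ k
  |s∩t|≤k = s≤s⁻¹ (subst (card (s ∩ t) <_) |t|≡1+k |s∩t|<|t|)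

⊨ρ∨σ⇒≢ : {t s : Team n} → card t ≡ suc k → s ⊨ (ρ t k ∨f σ t) → ¬ (s ≐ t)
⊨ρ∨σ⇒≢ {k = k} {t} {s} |t|≡1+k s⊨ρ∨σ s≐t = 1+n≰n (begin
  suc k   ≡⟨ sym |t|≡1+k ⟩
  card t  ≤⟨ card-mono {r = t} {s} (λ {v} t-v → trans (s≐t v) t-v) ⟩
  card s  ≤⟨ card-⊨ρ∨σ-inside s⊨ρ∨σ (λ {v} s-v → trans (sym (s≐t v)) s-v) ⟩
  k       ∎)
  where open ≤-Reasoning

≢⇒⊨ρ∨σ : {t s : Team n} → card t ≡ suc k → ¬ (s ≐ t) → s ⊨ (ρ t k ∨f σ t)
≢⇒⊨ρ∨σ {k = k} {t} {s} |t|≡1+k s≢t with ¬≐⇒∃≢ s≢t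
... | v , sv≢tv with s v in s-v | t v in t-v
... | true | false = ⊨∨-introʳ {φ = ρ t k} (⊨σ⁺ {u = v} s-v t-v)
... | false | true = ⊨∨-introˡ {φ = ρ t k} {σ t} (⊨ρ⁺ |t|≡1+k t-v s-v)
... | true | true = ⊥-elim (sv≢tv refl)
... | false | false = ⊥-elim (sv≢tv refl)

mainTheorem7 : (n : ℕ) (t : Team n) (k : ℕ) → card t ≡ suc k →
    (s : Team n) → (s ⊨ (ρ t k ∨f σ t)) ⇔ (¬ (s ≐ t))
mainTheorem7 n t k |t|≡1+k s = mk⇔ (⊨ρ∨σ⇒≢ |t|≡1+k) (≢⇒⊨ρ∨σ |t|≡1+k)
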